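{- Let $G$ and $H$ be connected graphs, each of order at least two. If $G\cong K_{2}$ or $H\cong K_{2}$, then $\chi_{i}(G\times H)=\max\{\chi_{i}(G),\chi_{i}(H)\}$. If $\Delta(G)\geq 2$ and $\Delta(H)\geq2$, then $$\max\{\chi_{i}(G)+\Delta(H),\ \chi_{i}(H)+\Delta(G)\}\leq \chi_{i}(G\times H)\leq \chi_{i}(G)\chi_{i}(H),$$ and both of these bounds are sharp (each is attained with equality by some pair of connected graphs $G,H$ with $\Delta(G),\Delta(H)\ge 2$).
   Context: All graphs are finite and simple. An injective $k$-coloring of a graph $G$ is a function $f:V(G)\to\{1,\dots,k\}$ such that no vertex is adjacent to two distinct vertices $u,w$ with $f(u)=f(w)$ (adjacent vertices may share a color). The injective chromatic number $\chi_i(G)$ is the minimum $k$ for which $G$ admits an injective $k$-coloring. $\Delta(G)$ is the maximum degree of $G$. The direct product $G\times H$ has vertex set $V(G)\times V(H)$, with $(g,h)(g',h')$ an edge iff $gg'\in E(G)$ and $hh'\in E(H)$. -}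

module Defs where

open import Data.Nat using (ℕ; zero; suc; _+_; _*_; _≤_; _⊔_)
open import Data.Fin using (Fin; remQuot; zero; suc)
open import Data.Bool using (Bool; true; false; _∧_; if_then_else_)
open import Data.Bool.Properties using (∧-comm)
open import Data.List using (List; map; allFin; foldr)
open import Data.Nat.ListAction using (sum)
open import Data.Product using (Σ; _×_; _,_; proj₁; proj₂; ∃)
open import Relation.Binary.PropositionalEquality using (_≡_; refl; cong₂)

record Graph : Set where
  field
    order  : ℕ
    adj    : Fin order → Fin order → Bool
    sym    : ∀ u v → adj u v ≡ adj v u
    irrefl : ∀ v → adj v v ≡ false
open Graph public

Adj : (G : Graph) → Fin (order G) → Fin (order G) → Set
Adj G u v = adj G u v ≡ true

degree : (G : Graph) → Fin (order G) → ℕ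
degree G v = sum (map (λ u → if adj G v u then 1 else 0) (allFin (order G)))

Δ : Graph → ℕ
Δ G = foldr _⊔_ 0 (map (degree G) (allFin (order G)))

data Reach (G : Graph) : Fin (order G) → Fin (order G) → Set where
  here : ∀ {v} → Reach G v v
  step : ∀ {u w v} → Adj G u w → Reach G w v → Reach G u v

Connected : Graph → Set
Connected G = ∀ u v → Reach G u v

record _≅_ (G H : Graph) : Set where
  field
    to      : Fin (order G) → Fin (order H)
    from    : Fin (order H) → Fin (order G)
    from-to : ∀ x → from (to x) ≡ x
    to-from : ∀ y → to (from y) ≡ y
    adj-pres : ∀ u v → adj H (to u) (to v) ≡ adj G u v

K₂adj : Fin 2 → Fin 2 → Bool
K₂adj zero zero = false
K₂adj zero (suc zero) = true
K₂adj (suc zero) zero = true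
K₂adj (suc zero) (suc zero) = false

K₂ : Graph
K₂ = record
  { order = 2 ; adj = K₂adj
  ; sym = λ { zero zero → refl ; zero (suc zero) → refl
            ; (suc zero) zero → refl ; (suc zero) (suc zero) → refl }
  ; irrefl = λ { zero → refl ; (suc zero) → refl } }

-- direct (tensor) product G × H, vertex (g,h) encoded in Fin (|G| * |H|)
-- via Data.Fin.remQuot / combine
-- first and second coordinates of an encoded product vertex
fstV : (G H : Graph) → Fin (order G * order H) → Fin (order G)
fstV G H x = proj₁ (remQuot {order G} (order H) x)

sndV : (G H : Graph) → Fin (order G * order H) → Fin (order H)
sndV G H x = proj₂ (remQuot {order G} (order H) x)

×adj : (G H : Graph) → Fin (order G * order H) → Fin (order G * order H) → Bool
×adj G H x y = adj G (fstV G H x) (fstV G H y) ∧ adj H (sndV G H x) (sndV G H y)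

×irrefl : (G H : Graph) → ∀ x → ×adj G H x x ≡ false
×irrefl G H x rewrite irrefl G (fstV G H x) = refl

_⊗_ : Graph → Graph → Graph
G ⊗ H = record
  { order = order G * order H
  ; adj = ×adj G H
  ; sym = λ x y → cong₂ _∧_ (sym G (fstV G H x) (fstV G H y))
                            (sym H (sndV G H x) (sndV G H y))
  ; irrefl = ×irrefl G H }

InjectiveColoring : (G : Graph) (k : ℕ) → (Fin (order G) → Fin k) → Set
InjectiveColoring G k f =
  ∀ v u w → Adj G v u → Adj G v w → f u ≡ f w → u ≡ w

InjColorable : Graph → ℕ → Set
InjColorable G k = Σ (Fin (order G) → Fin k) (InjectiveColoring G k)

IsInjChromatic : Graph → ℕ → Set
IsInjChromatic G k = InjColorable G k × (∀ m → InjColorable G m → k ≤ m)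

Admissible : Graph → Set
Admissible G = Connected G × 2 ≤ order G

-- Read in coordinates, an injective colouring of G × H is a map F under which every
-- N(g) × N(h) receives pairwise distinct colours; products of injective colourings of
-- G and H are such maps, so χᵢ(G × H) ≤ χᵢ(G) χᵢ(H).
-- For the lower bound let F use c colours, fix h with D = Δ(H) neighbours e₁,…,e_D,
-- put T = c − D − 1 and colour g by min(T, F(g,e₁), …, F(g,e_D)). Two neighbours u ≠ w
-- of a common vertex v get different colours: a common value below T would repeat a
-- colour on N(v) × N(h), and a common value T would squeeze the 2D distinct colours
-- F(u,eⱼ), F(w,eⱼ) into the D + 1 colours ≥ T. So χᵢ(G) ≤ c − D.
-- If no vertex of G has two neighbours (as in K₂), injective colourings of H pulled
-- back along the projection are injective colourings of G × H, and conversely the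
-- fibre {g₁} × H over an edge g₀g₁ inherits an injective colouring of H; hence
-- χᵢ(G × H) = χᵢ(H) ≥ 1 ≥ χᵢ(G). Both bounds are attained by G = H = P₃.
{-# OPTIONS --safe #-}
module Submission where

open import Defs hiding (sym)
open import Data.Nat using (ℕ; zero; suc; _+_; _*_; _∸_; _≤_; _<_; _⊔_; z≤n; s≤s; s≤s⁻¹)
open import Data.Nat.Properties
  using (≤-refl; ≤-trans; ≤-antisym; ≤-reflexive; <⇒≤; <-irrefl; +-suc; +-comm; +-monoʳ-≤;
         +-monoˡ-≤; +-cancelˡ-≤; ⊔-sel; ⊔-comm; ⊔-lub; m≤n⇒m⊔n≡n; m≤n+o⇒m∸n≤o; m∸n+n≡m;
         ∸-monoˡ-<; ∸-cancelʳ-≡; module ≤-Reasoning)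
open import Data.Fin using (Fin; zero; suc; toℕ; fromℕ<; combine; splitAt; join; lift)
open import Data.Fin.Properties
  using (¬Fin0; 0≢1+n; toℕ<n; toℕ-injective; fromℕ<-injective; injective⇒≤; remQuot-combine;
         combine-remQuot; combine-injective; join-splitAt; lift-injective; suc-injective; all?)
  renaming (_≟_ to _≟ᶠ_)
open import Data.Bool using (Bool; true; false; _∧_; _xor_; if_then_else_)
open import Data.Bool.Properties using (xor-comm; xor-same) renaming (_≟_ to _≟ᵇ_)
open import Data.List using (map; allFin; tabulate)
open import Data.List.Properties using (map-tabulate)
open import Data.List.Membership.Propositional.Properties
  using (foldr-selective; ∈-map⁻; ∈-tabulate⁺; ∈-tabulate⁻)
open import Data.List.Relation.Unary.All using (lookup)
open import Data.List.Extrema.Nat using (min; argmin-sel; min≤⊤; min≤xs)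
open import Data.Nat.ListAction using (sum)
open import Data.Product using (Σ; _×_; _,_; proj₁; proj₂; swap)
open import Data.Sum using (_⊎_; inj₁; inj₂)
open import Data.Empty using (⊥; ⊥-elim)
open import Function using (_∘_; Injective)
open import Relation.Nullary using (¬_; yes; no)
open import Relation.Nullary.Decidable using (Dec; _→-dec_; from-yes)
open import Relation.Binary.PropositionalEquality
  using (_≡_; _≢_; refl; sym; trans; cong; cong₂; subst; subst₂)

∧-true⁻ : ∀ {x y} → x ∧ y ≡ true → x ≡ true × y ≡ true
∧-true⁻ {true} {true} refl = refl , refl

∧-true⁺ : ∀ {x y} → x ≡ true → y ≡ true → x ∧ y ≡ true
∧-true⁺ refl refl = refl

Reach-trans : ∀ {G u w v} → Reach G u w → Reach G w v → Reach G u v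
Reach-trans here q = q
Reach-trans (step a p) q = step a (Reach-trans p q)

injectiveColoring? : ∀ G k f → Dec (InjectiveColoring G k f)
injectiveColoring? G k f =
  all? λ v → all? λ u → all? λ w →
    (adj G v u ≟ᵇ true) →-dec ((adj G v w ≟ᵇ true) →-dec ((f u ≟ᶠ f w) →-dec (u ≟ᶠ w)))

injective⇒≤-above : ∀ {m n T} {f : Fin m → Fin n} → Injective _≡_ _≡_ f →
                    (∀ i → T ≤ toℕ (f i)) → m ≤ n ∸ T
injective⇒≤-above {m} {n} {T} {f} f-inj above = injective⇒≤ shifted-injective
  where
  shift : ∀ i → toℕ (f i) ∸ T < n ∸ T
  shift i = ∸-monoˡ-< (toℕ<n (f i)) (above i)
  shifted-injective : Injective _≡_ _≡_ (λ i → fromℕ< (shift i))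
  shifted-injective {i} {j} eq =
    f-inj (toℕ-injective (∸-cancelʳ-≡ (above i) (above j) (fromℕ<-injective _ _ (shift i) (shift j) eq)))

count : ∀ {n} → (Fin n → Bool) → ℕ
count p = sum (tabulate (λ i → if p i then 1 else 0))

degree≡count : ∀ G v → degree G v ≡ count (adj G v)
degree≡count G v = cong sum (map-tabulate (λ i → i) (λ u → if adj G v u then 1 else 0))

Embedding : ∀ {n} → (Fin n → Bool) → ℕ → Set
Embedding {n} p k = Σ (Fin k → Fin n) λ e → Injective _≡_ _≡_ e × (∀ j → p (e j) ≡ true)

≤count⇒embedding : ∀ {n} (p : Fin n → Bool) {k} → k ≤ count p → Embedding p k
≤count⇒embedding p {zero} _ = (λ ()) , (λ {i} → ⊥-elim (¬Fin0 i)) , λ ()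
≤count⇒embedding {suc n} p {suc k} k≤ with p zero in p0
... | true  = let e , e-inj , pe = ≤count⇒embedding (p ∘ suc) (s≤s⁻¹ k≤)
              in lift 1 e , lift-injective e e-inj 1 , λ { zero → p0 ; (suc j) → pe j }
... | false = let e , e-inj , pe = ≤count⇒embedding (p ∘ suc) k≤
              in suc ∘ e , e-inj ∘ suc-injective , pe

NeighbourEmbedding : (G : Graph) → Fin (order G) → ℕ → Set
NeighbourEmbedding G v = Embedding (adj G v)

maxDegreeVertex : ∀ G → 1 ≤ Δ G → Σ (Fin (order G)) λ v → Δ G ≡ degree G v
maxDegreeVertex G 1≤Δ with foldr-selective ⊔-sel 0 (map (degree G) (allFin (order G)))
... | inj₁ Δ≡0 = ⊥-elim (<-irrefl (sym Δ≡0) 1≤Δ)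
... | inj₂ Δ∈  = let v , _ , Δ≡ = ∈-map⁻ (degree G) Δ∈ in v , Δ≡

Δ-embedding : ∀ G {k} → k ≤ Δ G → 1 ≤ Δ G → Σ (Fin (order G)) λ v → NeighbourEmbedding G v k
Δ-embedding G k≤Δ 1≤Δ =
  let v , Δ≡ = maxDegreeVertex G 1≤Δ
  in v , ≤count⇒embedding (adj G v) (≤-trans k≤Δ (≤-reflexive (trans Δ≡ (degree≡count G v))))

embedding⇒≤colours : ∀ G {v k m} → NeighbourEmbedding G v k → InjColorable G m → k ≤ m
embedding⇒≤colours G {v} (e , e-inj , e-adj) (f , f-inj) =
  injective⇒≤ λ {i} {j} eq → e-inj (f-inj v (e i) (e j) (e-adj i) (e-adj j) eq)

module _ (G H : Graph) where

  fstV-combine : ∀ g h → fstV G H (combine g h) ≡ g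
  fstV-combine g h = cong proj₁ (remQuot-combine {order G} {order H} g h)

  sndV-combine : ∀ g h → sndV G H (combine g h) ≡ h
  sndV-combine g h = cong proj₂ (remQuot-combine {order G} {order H} g h)

  ⊗-vertex-≡ : ∀ {x y} → fstV G H x ≡ fstV G H y → sndV G H x ≡ sndV G H y → x ≡ y
  ⊗-vertex-≡ {x} {y} fst≡ snd≡ =
    trans (sym (combine-remQuot {order G} (order H) x))
          (trans (cong₂ combine fst≡ snd≡) (combine-remQuot {order G} (order H) y))

  Adj-⊗⁺ : ∀ {g g′ h h′} → Adj G g g′ → Adj H h h′ → Adj (G ⊗ H) (combine g h) (combine g′ h′)
  Adj-⊗⁺ {g} {g′} {h} {h′} gg′ hh′ =
    ∧-true⁺ (subst₂ (Adj G) (sym (fstV-combine g h)) (sym (fstV-combine g′ h′)) gg′)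
            (subst₂ (Adj H) (sym (sndV-combine g h)) (sym (sndV-combine g′ h′)) hh′)

  Adj-⊗⁻ : ∀ {x y} → Adj (G ⊗ H) x y → Adj G (fstV G H x) (fstV G H y) × Adj H (sndV G H x) (sndV G H y)
  Adj-⊗⁻ = ∧-true⁻

  InjectiveColoring⊗ : (k : ℕ) → (Fin (order G) → Fin (order H) → Fin k) → Set
  InjectiveColoring⊗ k F =
    ∀ {g g₁ g₂ h h₁ h₂} → Adj G g g₁ → Adj G g g₂ → Adj H h h₁ → Adj H h h₂ →
    F g₁ h₁ ≡ F g₂ h₂ → g₁ ≡ g₂ × h₁ ≡ h₂

  InjColorable⊗ : ℕ → Set
  InjColorable⊗ k = Σ (Fin (order G) → Fin (order H) → Fin k) (InjectiveColoring⊗ k)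

  InjColorable⊗⇒InjColorable : ∀ {k} → InjColorable⊗ k → InjColorable (G ⊗ H) k
  InjColorable⊗⇒InjColorable (F , F-inj) =
    (λ x → F (fstV G H x) (sndV G H x)) ,
    λ v u w vu vw eq →
      let vuG , vuH = Adj-⊗⁻ vu
          vwG , vwH = Adj-⊗⁻ vw
          fst≡ , snd≡ = F-inj vuG vwG vuH vwH eq
      in ⊗-vertex-≡ fst≡ snd≡

  InjColorable⇒InjColorable⊗ : ∀ {k} → InjColorable (G ⊗ H) k → InjColorable⊗ k
  InjColorable⇒InjColorable⊗ (f , f-inj) =
    (λ g h → f (combine g h)) ,
    λ gg₁ gg₂ hh₁ hh₂ eq →
      combine-injective _ _ _ _ (f-inj _ _ _ (Adj-⊗⁺ gg₁ hh₁) (Adj-⊗⁺ gg₂ hh₂) eq)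

InjColorable⊗-swap : ∀ G H {k} → InjColorable⊗ G H k → InjColorable⊗ H G k
InjColorable⊗-swap G H (F , F-inj) =
  (λ h g → F g h) , λ hh₁ hh₂ gg₁ gg₂ eq → swap (F-inj gg₁ gg₂ hh₁ hh₂ eq)

IsInjChromatic-⊗-comm : ∀ G H {c} → IsInjChromatic (G ⊗ H) c → IsInjChromatic (H ⊗ G) c
IsInjChromatic-⊗-comm G H (colorable , minimal) =
  swapped G H colorable , λ m HG-colorable → minimal m (swapped H G HG-colorable)
  where
  swapped : ∀ G H {k} → InjColorable (G ⊗ H) k → InjColorable (H ⊗ G) k
  swapped G H = InjColorable⊗⇒InjColorable H G ∘ InjColorable⊗-swap G H ∘ InjColorable⇒InjColorable⊗ G H

InjColorable⊗-product : ∀ G H {a b} → InjColorable G a → InjColorable H b → InjColorable⊗ G H (a * b)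
InjColorable⊗-product G H (f , f-inj) (f′ , f′-inj) =
  (λ g h → combine (f g) (f′ h)) ,
  λ gg₁ gg₂ hh₁ hh₂ eq →
    let f≡ , f′≡ = combine-injective _ _ _ _ eq
    in f-inj _ _ _ gg₁ gg₂ f≡ , f′-inj _ _ _ hh₁ hh₂ f′≡

AtMostOneNeighbour : Graph → Set
AtMostOneNeighbour G = ∀ {g g₁ g₂} → Adj G g g₁ → Adj G g g₂ → g₁ ≡ g₂

K₂-atMostOneNeighbour : AtMostOneNeighbour K₂
K₂-atMostOneNeighbour {zero}     {suc zero} {suc zero} _ _ = refl
K₂-atMostOneNeighbour {suc zero} {zero}     {zero}     _ _ = refl
K₂-atMostOneNeighbour {zero}     {zero}     ()
K₂-atMostOneNeighbour {zero}     {suc zero} {zero}     _ ()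
K₂-atMostOneNeighbour {suc zero} {suc zero} ()
K₂-atMostOneNeighbour {suc zero} {zero}     {suc zero} _ ()

module _ {G : Graph} (iso : G ≅ K₂) where
  open _≅_ iso

  ≅K₂⇒atMostOneNeighbour : AtMostOneNeighbour G
  ≅K₂⇒atMostOneNeighbour {g} {g₁} {g₂} gg₁ gg₂ =
    trans (sym (from-to g₁))
      (trans (cong from (K₂-atMostOneNeighbour (trans (adj-pres g g₁) gg₁) (trans (adj-pres g g₂) gg₂)))
             (from-to g₂))

  ≅K₂⇒edge : Adj G (from zero) (from (suc zero))
  ≅K₂⇒edge =
    trans (sym (adj-pres (from zero) (from (suc zero)))) (cong₂ K₂adj (to-from zero) (to-from (suc zero)))

module _ {G H : Graph} {k : ℕ} where

  InjColorable⊗-lift : AtMostOneNeighbour G → InjColorable H k → InjColorable⊗ G H k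
  InjColorable⊗-lift G-one (f , f-inj) =
    (λ _ h → f h) , λ gg₁ gg₂ hh₁ hh₂ eq → G-one gg₁ gg₂ , f-inj _ _ _ hh₁ hh₂ eq

  InjColorable⊗-restrict : ∀ {g₀ g₁} → Adj G g₀ g₁ → InjColorable⊗ G H k → InjColorable H k
  InjColorable⊗-restrict {g₁ = g₁} g₀g₁ (F , F-inj) =
    (λ h → F g₁ h) , λ h h₁ h₂ hh₁ hh₂ eq → proj₂ (F-inj g₀g₁ g₀g₁ hh₁ hh₂ eq)

InjColorable-one : ∀ {G} → AtMostOneNeighbour G → InjColorable G 1
InjColorable-one G-one = (λ _ → zero) , λ _ _ _ vu vw _ → G-one vu vw

χᵢ⊗-atMostOneNeighbour : ∀ {G H a b c g₀ g₁} → AtMostOneNeighbour G → Adj G g₀ g₁ → Fin (order H) →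
                          IsInjChromatic G a → IsInjChromatic H b → IsInjChromatic (G ⊗ H) c → c ≡ a ⊔ b
χᵢ⊗-atMostOneNeighbour {G} {H} {a} {b} {c} G-one g₀g₁ h (_ , a-min) (H-col , b-min) (GH-col , c-min) =
  trans (≤-antisym c≤b b≤c) (sym (m≤n⇒m⊔n≡n (≤-trans a≤1 1≤b)))
  where
  c≤b : c ≤ b
  c≤b = c-min b (InjColorable⊗⇒InjColorable G H (InjColorable⊗-lift {G} {H} G-one H-col))
  b≤c : b ≤ c
  b≤c = b-min c (InjColorable⊗-restrict {G} {H} g₀g₁ (InjColorable⇒InjColorable⊗ G H GH-col))
  a≤1 : a ≤ 1
  a≤1 = a-min 1 (InjColorable-one {G} G-one)
  1≤b : 1 ≤ b
  1≤b = ≤-trans (s≤s z≤n) (toℕ<n (proj₁ H-col h))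

module LowerBound {G H : Graph} {c : ℕ}
  (F : Fin (order G) → Fin (order H) → Fin c) (F-inj : InjectiveColoring⊗ G H c F)
  {h : Fin (order H)} {D : ℕ} (e : Fin D → Fin (order H))
  (e-inj : Injective _≡_ _≡_ e) (e-adj : ∀ j → Adj H h (e j)) where

  row : Fin (order G) → Fin D → Fin c
  row g j = F g (e j)

  rows : Fin (order G) → Fin (order G) → Fin D ⊎ Fin D → Fin c
  rows u w (inj₁ j) = row u j
  rows u w (inj₂ j) = row w j

  rows-injective : ∀ {v u w} → Adj G v u → Adj G v w → u ≢ w → Injective _≡_ _≡_ (rows u w ∘ splitAt D)
  rows-injective {u = u} {w} vu vw u≢w {i} {i′} eq =
    trans (sym (join-splitAt D D i)) (trans (cong (join D D) (distinct (splitAt D i) (splitAt D i′) eq))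
                                            (join-splitAt D D i′))
    where
    distinct : ∀ s s′ → rows u w s ≡ rows u w s′ → s ≡ s′
    distinct (inj₁ j) (inj₁ j′) eq = cong inj₁ (e-inj (proj₂ (F-inj vu vu (e-adj j) (e-adj j′) eq)))
    distinct (inj₁ j) (inj₂ j′) eq = ⊥-elim (u≢w (proj₁ (F-inj vu vw (e-adj j) (e-adj j′) eq)))
    distinct (inj₂ j) (inj₁ j′) eq = ⊥-elim (u≢w (proj₁ (F-inj vu vw (e-adj j′) (e-adj j) (sym eq))))
    distinct (inj₂ j) (inj₂ j′) eq = cong inj₂ (e-inj (proj₂ (F-inj vw vw (e-adj j) (e-adj j′) eq)))

  clippedMin : ℕ → Fin (order G) → ℕ
  clippedMin T g = min T (tabulate (toℕ ∘ row g))

  clippedMin≤row : ∀ T g j → clippedMin T g ≤ toℕ (row g j)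
  clippedMin≤row T g j = lookup (min≤xs T (tabulate (toℕ ∘ row g))) (∈-tabulate⁺ j)

  module _ {T : ℕ} (2≤D : 2 ≤ D) (c≤T+1+D : c ≤ T + suc D) where

    crowded : ∀ {v u w} → Adj G v u → Adj G v w → u ≢ w → clippedMin T u ≡ T → clippedMin T w ≡ T → ⊥
    crowded {u = u} {w} vu vw u≢w u≡T w≡T =
      too-few (≤-trans (injective⇒≤-above (rows-injective vu vw u≢w) above) (m≤n+o⇒m∸n≤o c T c≤T+1+D))
      where
      above : ∀ i → T ≤ toℕ (rows u w (splitAt D i))
      above i with splitAt D i
      ... | inj₁ j = subst (_≤ _) u≡T (clippedMin≤row T u j)
      ... | inj₂ j = subst (_≤ _) w≡T (clippedMin≤row T w j)
      too-few : ¬ (D + D ≤ suc D)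
      too-few D+D≤1+D
        with +-cancelˡ-≤ D 2 1 (≤-trans (+-monoʳ-≤ D 2≤D) (≤-trans D+D≤1+D (≤-reflexive (+-comm 1 D))))
      ... | s≤s ()

    clippedMin-injective : ∀ {v u w} → Adj G v u → Adj G v w → u ≢ w → clippedMin T u ≢ clippedMin T w
    clippedMin-injective {u = u} {w} vu vw u≢w eq
      with argmin-sel (λ x → x) T (tabulate (toℕ ∘ row u)) | argmin-sel (λ x → x) T (tabulate (toℕ ∘ row w))
    ... | inj₂ u∈ | inj₂ w∈ =
      let j  , u≡ = ∈-tabulate⁻ u∈
          j′ , w≡ = ∈-tabulate⁻ w∈
      in u≢w (proj₁ (F-inj vu vw (e-adj j) (e-adj j′) (toℕ-injective (trans (sym u≡) (trans eq w≡)))))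
    ... | inj₁ u≡T | _ = crowded vu vw u≢w u≡T (trans (sym eq) u≡T)
    ... | _ | inj₁ w≡T = crowded vu vw u≢w (trans eq w≡T) w≡T

    clippedColoring : InjColorable G (suc T)
    clippedColoring = (λ g → fromℕ< (clippedMin<1+T g)) , injective
      where
      clippedMin<1+T : ∀ g → clippedMin T g < suc T
      clippedMin<1+T g = s≤s (min≤⊤ T (tabulate (toℕ ∘ row g)))
      injective : InjectiveColoring G (suc T) (λ g → fromℕ< (clippedMin<1+T g))
      injective v u w vu vw eq with u ≟ᶠ w
      ... | yes u≡w = u≡w
      ... | no u≢w  = ⊥-elim (clippedMin-injective vu vw u≢w
                               (fromℕ<-injective _ _ (clippedMin<1+T u) (clippedMin<1+T w) eq))

  χᵢ+D≤ : ∀ {a v u w} → 2 ≤ D → Adj G v u → Adj G v w → u ≢ w →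
          (∀ m → InjColorable G m → a ≤ m) → a + D ≤ c
  χᵢ+D≤ {a} 2≤D vu vw u≢w a-min = begin
    a + D                 ≤⟨ +-monoˡ-≤ D (a-min _ (clippedColoring 2≤D c≤T+1+D)) ⟩
    suc (c ∸ suc D) + D   ≡⟨ sym (+-suc (c ∸ suc D) D) ⟩
    c ∸ suc D + suc D     ≡⟨ m∸n+n≡m 1+D≤c ⟩
    c                     ∎
    where
    open ≤-Reasoning
    1+D≤c : suc D ≤ c
    1+D≤c = ≤-trans (+-monoˡ-≤ D (<⇒≤ 2≤D)) (injective⇒≤ (rows-injective vu vw u≢w))
    c≤T+1+D : c ≤ c ∸ suc D + suc D
    c≤T+1+D = ≤-reflexive (sym (m∸n+n≡m 1+D≤c))

χᵢ+Δ≤χᵢ⊗ : ∀ G H {a c} → 2 ≤ Δ G → 2 ≤ Δ H →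
           IsInjChromatic G a → InjColorable⊗ G H c → a + Δ H ≤ c
χᵢ+Δ≤χᵢ⊗ G H 2≤ΔG 2≤ΔH (_ , a-min) (F , F-inj) =
  let h , e , e-inj , e-adj     = Δ-embedding H ≤-refl (<⇒≤ 2≤ΔH)
      _ , e₂ , e₂-inj , e₂-adj = Δ-embedding G 2≤ΔG (<⇒≤ 2≤ΔG)
  in LowerBound.χᵢ+D≤ {G} {H} F F-inj {h} e e-inj e-adj
       2≤ΔH (e₂-adj zero) (e₂-adj (suc zero)) (0≢1+n ∘ e₂-inj) a-min

χᵢ⊗-bounds : ∀ G H {a b c} → 2 ≤ Δ G → 2 ≤ Δ H →
             IsInjChromatic G a → IsInjChromatic H b → IsInjChromatic (G ⊗ H) c →
             (a + Δ H) ⊔ (b + Δ G) ≤ c × c ≤ a * b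
χᵢ⊗-bounds G H {a} {b} 2≤ΔG 2≤ΔH χG χH (GH-col , c-min) =
  ⊔-lub (χᵢ+Δ≤χᵢ⊗ G H 2≤ΔG 2≤ΔH χG GH-col⊗)
        (χᵢ+Δ≤χᵢ⊗ H G 2≤ΔH 2≤ΔG χH (InjColorable⊗-swap G H GH-col⊗)) ,
  c-min (a * b) (InjColorable⊗⇒InjColorable G H (InjColorable⊗-product G H (proj₁ χG) (proj₁ χH)))
  where
  GH-col⊗ : InjColorable⊗ G H _
  GH-col⊗ = InjColorable⇒InjColorable⊗ G H GH-col

χᵢ⊗K₂ : ∀ G H {a b c} → G ≅ K₂ → 2 ≤ order H →
        IsInjChromatic G a → IsInjChromatic H b → IsInjChromatic (G ⊗ H) c → c ≡ a ⊔ b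
χᵢ⊗K₂ G H G≅K₂ 2≤|H| =
  χᵢ⊗-atMostOneNeighbour {G} {H} (≅K₂⇒atMostOneNeighbour G≅K₂) (≅K₂⇒edge G≅K₂) (fromℕ< (<⇒≤ 2≤|H|))

isCentre : Fin 3 → Bool
isCentre (suc zero) = true
isCentre _          = false

P₃ : Graph
P₃ = record
  { order  = 3
  ; adj    = λ u v → isCentre u xor isCentre v
  ; sym    = λ u v → xor-comm (isCentre u) (isCentre v)
  ; irrefl = λ v → xor-same (isCentre v) }

P₃-admissible : Admissible P₃
P₃-admissible = (λ u v → Reach-trans (toCentre u) (fromCentre v)) , s≤s (s≤s z≤n)
  where
  toCentre : ∀ u → Reach P₃ u (suc zero)
  toCentre zero             = step refl here
  toCentre (suc zero)       = here
  toCentre (suc (suc zero)) = step refl here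
  fromCentre : ∀ v → Reach P₃ (suc zero) v
  fromCentre zero             = step refl here
  fromCentre (suc zero)       = here
  fromCentre (suc (suc zero)) = step refl here

P₃-χᵢ : IsInjChromatic P₃ 2
P₃-χᵢ = (colour , from-yes (injectiveColoring? P₃ 2 colour)) ,
        λ m → embedding⇒≤colours P₃ (proj₂ (Δ-embedding P₃ ≤-refl (s≤s z≤n)))
  where
  colour : Fin 3 → Fin 2
  colour (suc (suc zero)) = suc zero
  colour _                = zero

P₃⊗P₃-χᵢ : IsInjChromatic (P₃ ⊗ P₃) 4
P₃⊗P₃-χᵢ =
  InjColorable⊗⇒InjColorable P₃ P₃ (InjColorable⊗-product P₃ P₃ (proj₁ P₃-χᵢ) (proj₁ P₃-χᵢ)) ,
  λ m P₃⊗P₃-col → χᵢ+Δ≤χᵢ⊗ P₃ P₃ ≤-refl ≤-refl P₃-χᵢ (InjColorable⇒InjColorable⊗ P₃ P₃ P₃⊗P₃-col)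

theorem2p2 : (∀ (G H : Graph) → Admissible G → Admissible H
    → (G ≅ K₂) ⊎ (H ≅ K₂)
    → ∀ a b c → IsInjChromatic G a → IsInjChromatic H b
    → IsInjChromatic (G ⊗ H) c → c ≡ a ⊔ b)
    × (∀ (G H : Graph) → Admissible G → Admissible H
    → 2 ≤ Δ G → 2 ≤ Δ H
    → ∀ a b c → IsInjChromatic G a → IsInjChromatic H b
    → IsInjChromatic (G ⊗ H) c
    → ((a + Δ H) ⊔ (b + Δ G) ≤ c) × (c ≤ a * b))
    × (Σ Graph λ G → Σ Graph λ H → Admissible G × Admissible H
    × 2 ≤ Δ G × 2 ≤ Δ H
    × Σ ℕ λ a → Σ ℕ λ b → Σ ℕ λ c
    → IsInjChromatic G a × IsInjChromatic H b
    × IsInjChromatic (G ⊗ H) c × c ≡ (a + Δ H) ⊔ (b + Δ G))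
    × (Σ Graph λ G → Σ Graph λ H → Admissible G × Admissible H
    × 2 ≤ Δ G × 2 ≤ Δ H
    × Σ ℕ λ a → Σ ℕ λ b → Σ ℕ λ c
    → IsInjChromatic G a × IsInjChromatic H b
    × IsInjChromatic (G ⊗ H) c × c ≡ a * b)
theorem2p2 =
  (λ where
    G H _ (_ , 2≤|H|) (inj₁ G≅K₂) a b c χG χH χGH → χᵢ⊗K₂ G H G≅K₂ 2≤|H| χG χH χGH
    G H (_ , 2≤|G|) _ (inj₂ H≅K₂) a b c χG χH χGH →
      trans (χᵢ⊗K₂ H G H≅K₂ 2≤|G| χH χG (IsInjChromatic-⊗-comm G H χGH)) (⊔-comm b a)) ,
  (λ G H _ _ 2≤ΔG 2≤ΔH a b c → χᵢ⊗-bounds G H 2≤ΔG 2≤ΔH) ,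
  (P₃ , P₃ , P₃-admissible , P₃-admissible , ≤-refl , ≤-refl , 2 , 2 , 4 , P₃-χᵢ , P₃-χᵢ , P₃⊗P₃-χᵢ , refl) ,
  (P₃ , P₃ , P₃-admissible , P₃-admissible , ≤-refl , ≤-refl , 2 , 2 , 4 , P₃-χᵢ , P₃-χᵢ , P₃⊗P₃-χᵢ , refl)
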